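{- Let $\mathbf{T}=\{T_c:c\in\Gamma\}$ be a collection of tournaments on a common vertex set and let $V_1,V_2\subseteq V(\mathbf{T})$ be disjoint with $|V_1|\ge50$ and $|V_2|\ge300$. For any oscillating path $P$ of length three and any set $B\subseteq\Gamma$ of three colors, $\mathbf{T}[V_1\cup V_2]$ contains a $B$-near-rainbow $(P,2,50)$-broom from $V_1$ to $V_2$.
   Context: An oriented path is oscillating if each of its blocks (maximal consistently oriented subpaths) has length at most $2$. For an oriented path $P=x_1\dots x_k$ ($k\ge2$) and integers $s_1,s_2$, a $(P,s_1,s_2)$-broom is obtained from $P$ by blowing up $x_1$ into $s_1$ vertices (start-tips) and $x_k$ into $s_2$ vertices (end-tips), new arcs keeping the orientation of the corresponding arc of $P$; it is from $V_1$ to $V_2$ if all start-tips lie in $V_1$ and all end-tips lie in $V_2$. A coloring of a broom $F$ is a map $\varphi:E(F)\to\Gamma$ with each arc $e$ in $T_{\varphi(e)}$; it is near-rainbow if all start-tip-arcs share a color, all end-tip-arcs share a color, and every path in $F$ from a start-tip to an end-tip receives distinct colors; $B$-near-rainbow means near-rainbow with all colors in $B$. $\mathbf{T}[X]$ is the collection of induced subtournaments on $X$. -}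

module Defs where

open import Data.Nat using (ℕ)
open import Data.Fin using (Fin)
open import Data.Fin.Subset using (Subset; _∈_; _∪_)
open import Data.Product using (Σ; _×_; _,_)
open import Data.Sum using (_⊎_)
open import Data.Empty using (⊥)
open import Relation.Nullary using (¬_)
open import Relation.Binary.PropositionalEquality using (_≡_; _≢_)

record Tournament (n : ℕ) : Set₁ where
  field
    arc     : Fin n → Fin n → Set
    irrefl  : ∀ u → ¬ arc u u
    total   : ∀ u v → u ≢ v → arc u v ⊎ arc v u
    antisym : ∀ u v → arc u v → ¬ arc v u
open Tournament public

Disjoint : ∀ {n} → Subset n → Subset n → Set
Disjoint {n} X Y = ∀ (x : Fin n) → x ∈ X → x ∈ Y → ⊥

-- Oriented paths of length three  P = x₁ x₂ x₃ x₄.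
-- The arc between x_i and x_{i+1} is either forward (x_i → x_{i+1})
-- or backward (x_{i+1} → x_i).

data Dir : Set where
  fwd bwd : Dir

record Path3 : Set where
  constructor path3
  field
    d₁ d₂ d₃ : Dir
open Path3 public

-- Every block has length ≤ 2 iff no
-- consistently oriented subpath of length 3 exists; for a path of
-- length 3 the only such candidate is the whole path.
Oscillating : Path3 → Set
Oscillating P = ¬ (d₁ P ≡ d₂ P × d₂ P ≡ d₃ P)

-- The (P,s₁,s₂)-broom for a path P of length 3.
-- Vertices: s₁ start-tips (blow-up of x₁), x₂, x₃, s₂ end-tips (blow-up of x₄).

data BroomV (s₁ s₂ : ℕ) : Set where
  start : Fin s₁ → BroomV s₁ s₂
  mid₂  : BroomV s₁ s₂
  mid₃  : BroomV s₁ s₂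
  end   : Fin s₂ → BroomV s₁ s₂

data BroomA (s₁ s₂ : ℕ) : Set where
  startArc : Fin s₁ → BroomA s₁ s₂
  midArc   : BroomA s₁ s₂
  endArc   : Fin s₂ → BroomA s₁ s₂

orient : {A : Set} → Dir → A → A → A × A
orient fwd a b = a , b
orient bwd a b = b , a

arcEnds : ∀ {s₁ s₂} → Path3 → BroomA s₁ s₂ → BroomV s₁ s₂ × BroomV s₁ s₂
arcEnds P (startArc i) = orient (d₁ P) (start i) mid₂
arcEnds P midArc       = orient (d₂ P) mid₂ mid₃
arcEnds P (endArc j)   = orient (d₃ P) mid₃ (end j)

ArcIn : ∀ {n} → Tournament n → Fin n × Fin n → Set
ArcIn T (u , v) = arc T u v

mapPair : {A B : Set} → (A → B) → A × A → B × B
mapPair f (a , b) = f a , f b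

Distinct3 : {A : Set} → A → A → A → Set
Distinct3 a b c = (a ≢ b) × (a ≢ c) × (b ≢ c)

-- Near-rainbow: all start-tip-arcs share a colour, all end-tip-arcs share a
-- colour, and every start-tip-to-end-tip path (start i, x₂, x₃, end j — the
-- only such paths, the broom being a tree) receives distinct colours.
NearRainbow : ∀ {s₁ s₂} {Γ : Set} → (BroomA s₁ s₂ → Γ) → Set
NearRainbow {s₁} {s₂} χ =
  (∀ i i' → χ (startArc i) ≡ χ (startArc i')) ×
  (∀ j j' → χ (endArc j) ≡ χ (endArc j')) ×
  (∀ i j → Distinct3 (χ (startArc i)) (χ midArc) (χ (endArc j)))

ContainsNRBroom : ∀ {n} {Γ : Set} → (Γ → Tournament n) → (B : Γ → Set) →
                  (X V₁ V₂ : Subset n) → Path3 → (s₁ s₂ : ℕ) → Set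
ContainsNRBroom {n} {Γ} T B X V₁ V₂ P s₁ s₂ =
  Σ (BroomV s₁ s₂ → Fin n) λ φ →
  Σ (BroomA s₁ s₂ → Γ) λ χ →
    (∀ a b → φ a ≡ φ b → a ≡ b) ×
    (∀ v → φ v ∈ X) ×
    (∀ i → φ (start i) ∈ V₁) ×
    (∀ j → φ (end j) ∈ V₂) ×
    (∀ e → B (χ e)) ×
    (∀ e → ArcIn (T (χ e)) (mapPair φ (arcEnds P e))) ×
    NearRainbow χ

{-# OPTIONS --safe #-}
-- A tournament on m ≥ 2k + 1 vertices has a vertex of out-degree at least k: the
-- out-degrees add up to m(m − 1)/2. Applied inside V₁ or V₂ in a suitable colour,
-- this produces vertices whose monochromatic neighbourhoods supply the start-tips
-- or end-tips of the broom, and the colour of the remaining arcs decides which of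
-- these vertices serve as x₂ and x₃. An oscillating path of length three changes
-- direction either at x₃ or only at x₂.
module Submission where

open import Defs
open import Data.Nat using (ℕ; _≤_)
open import Data.Fin.Subset using (Subset; _∪_; ∣_∣)
open import Data.Sum using (_⊎_)
open import Data.Product using (_×_)
open import Relation.Binary.PropositionalEquality using (_≡_; _≢_)

open import Data.Fin as Fin using (Fin; zero; suc; _≟_)
open import Data.Fin.Properties using (inject≤-injective; suc-injective)
open import Data.Fin.Subset using (_∈_; inside; outside)
open import Data.Fin.Subset.Properties using (x∈p∪q⁺)
open import Data.List using (List; []; _∷_; length; filter; map; lookup)
open import Data.List.Properties using (length-map; filter-all)
open import Data.List.Membership.Propositional.Properties using (∈-lookup)
open import Data.List.Relation.Unary.All as All using (All; []; _∷_)
import Data.List.Relation.Unary.All.Properties as All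
open import Data.List.Relation.Unary.AllPairs using ([]; _∷_)
open import Data.List.Relation.Unary.Any as Any using (any?)
open import Data.List.Relation.Unary.Unique.Propositional using (Unique)
import Data.List.Relation.Unary.Unique.Propositional.Properties as Unique
open import Data.Nat using (suc; _+_; _*_; _<_; z≤n; s≤s; s≤s⁻¹; _≤?_; NonZero; >-nonZero)
open import Data.Nat.ListAction using (sum)
open import Data.Nat.Properties
  using (≤-refl; ≤-reflexive; ≤-trans; n≤1+n; m≤m+n; m≤n+m; <⇒≱; ≰⇒>; +-suc; +-assoc; *-suc; +-mono-≤; +-monoˡ-≤; +-monoʳ-≤
        ; +-mono-<; *-monoʳ-≤; *-cancelˡ-≤; +-commutativeSemigroup; module ≤-Reasoning)
open import Algebra.Properties.CommutativeSemigroup +-commutativeSemigroup using (x∙yz≈y∙xz)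
open import Data.Nat.Tactic.RingSolver using (solve-∀)
open import Data.Product as Product using (∃; ∃₂; _,_; proj₁; proj₂)
open import Data.Sum as Sum using (inj₁; inj₂; [_,_])
open import Data.Vec using ([]; _∷_; here; there)
open import Function using (id; _∘_)
open import Level using (0ℓ)
open import Relation.Binary using (DecidableEquality)
open import Relation.Binary.PropositionalEquality using (refl; sym; trans; cong; cong₂; ≢-sym)
open import Relation.Nullary using (¬_; Dec; yes; no; ¬?; contradiction)
open import Relation.Nullary.Decidable using (True; toSum; toWitness)
open import Relation.Unary using (Pred; Decidable; _⊆_; _∩_; ∁)
open import Relation.Unary.Properties using (∁?)

m+n≤o+p⇒m≤o⊎n≤p : ∀ {m n o p} → m + n ≤ o + p → m ≤ o ⊎ n ≤ p
m+n≤o+p⇒m≤o⊎n≤p {m} {n} {o} {p} m+n≤o+p with m ≤? o | n ≤? p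
... | yes m≤o | _       = inj₁ m≤o
... | no _    | yes n≤p = inj₂ n≤p
... | no m≰o  | no n≰p  = contradiction m+n≤o+p (<⇒≱ (+-mono-< (≰⇒> m≰o) (≰⇒> n≰p)))

sum-map-< : ∀ {A : Set} (f : A → ℕ) {k} {xs : List A} → All (λ x → f x < k) xs →
            sum (map f xs) + length xs ≤ length xs * k
sum-map-< f []                = z≤n
sum-map-< f {k} {x ∷ xs} (fx<k ∷ fxs<k) = begin
  f x + sum (map f xs) + suc (length xs)   ≡⟨ shift (f x) (sum (map f xs)) (length xs) ⟩
  suc (f x) + (sum (map f xs) + length xs) ≤⟨ +-mono-≤ fx<k (sum-map-< f fxs<k) ⟩
  k + length xs * k                        ∎
  where
  open ≤-Reasoning
  shift : ∀ a s l → a + s + suc l ≡ suc a + (s + l)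
  shift = solve-∀

m²≤m+2s⇒s+m≤mk⇒m<2k : ∀ {m s k} .{{_ : NonZero m}} → m * m ≤ m + 2 * s → s + m ≤ m * k → m < 2 * k
m²≤m+2s⇒s+m≤mk⇒m<2k {m} {s} {k} m²≤ s+m≤ = *-cancelˡ-≤ m (begin
  m * suc m           ≡⟨ *-suc m m ⟩
  m + m * m           ≤⟨ +-monoʳ-≤ m m²≤ ⟩
  m + (m + 2 * s)     ≡⟨ regroup m s ⟩
  2 * (s + m)         ≤⟨ *-monoʳ-≤ 2 s+m≤ ⟩
  2 * (m * k)         ≡⟨ reorder m k ⟩
  m * (2 * k)         ∎)
  where
  open ≤-Reasoning
  regroup : ∀ m s → m + (m + 2 * s) ≡ 2 * (s + m)
  regroup = solve-∀
  reorder : ∀ m k → 2 * (m * k) ≡ m * (2 * k)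
  reorder = solve-∀

module _ {A : Set} where

  lookup-injective : ∀ {xs : List A} → Unique xs → ∀ {i j} → lookup xs i ≡ lookup xs j → i ≡ j
  lookup-injective (_ ∷ _)      {zero}  {zero}  _  = refl
  lookup-injective (x∉xs ∷ _)   {zero}  {suc j} eq = contradiction eq (All.lookup x∉xs (∈-lookup j))
  lookup-injective (x∉xs ∷ _)   {suc i} {zero}  eq = contradiction (sym eq) (All.lookup x∉xs (∈-lookup i))
  lookup-injective (_ ∷ unique) {suc i} {suc j} eq = cong suc (lookup-injective unique eq)

  length-filter-cover : ∀ {P P′ : Pred A 0ℓ} (P? : Decidable P) (P′? : Decidable P′) {xs} →
                        All (λ x → P x ⊎ P′ x) xs → length xs ≤ length (filter P? xs) + length (filter P′? xs)
  length-filter-cover P? P′? [] = z≤n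
  length-filter-cover P? P′? {x ∷ xs} (px ∷ pxs) with ih ← length-filter-cover P? P′? pxs | P? x | P′? x
  ... | yes _ | yes _  = s≤s (≤-trans ih (+-monoʳ-≤ _ (n≤1+n _)))
  ... | yes _ | no _   = s≤s ih
  ... | no _  | yes _  = ≤-trans (s≤s ih) (≤-reflexive (sym (+-suc _ _)))
  ... | no ¬p | no ¬p′ = contradiction px [ ¬p , ¬p′ ]

  length-filter-≢ : (_≟_ : DecidableEquality A) (y : A) {xs : List A} → Unique xs →
                    length xs ≤ suc (length (filter (λ u → ¬? (u ≟ y)) xs))
  length-filter-≢ _≟_ y [] = z≤n
  length-filter-≢ _≟_ y {x ∷ xs} (x∉xs ∷ unique) with x ≟ y
  ... | yes refl = s≤s (≤-reflexive (sym (cong length (filter-all (λ u → ¬? (u ≟ y)) (All.map ≢-sym x∉xs)))))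
  ... | no _     = s≤s (length-filter-≢ _≟_ y unique)

  record AtLeast (k : ℕ) (P : Pred A 0ℓ) : Set where
    field
      members : List A
      unique  : Unique members
      size    : k ≤ length members
      all     : All P members

  open AtLeast public

  module _ {P : Pred A 0ℓ} where

    empty : AtLeast 0 P
    empty = record { members = [] ; unique = [] ; size = z≤n ; all = [] }

    cons : ∀ {k x} → P x → AtLeast k (λ y → x ≢ y × P y) → AtLeast (suc k) P
    cons px ys = record
      { members = _ ∷ members ys
      ; unique  = All.map proj₁ (all ys) ∷ unique ys
      ; size    = s≤s (size ys)
      ; all     = px ∷ All.map proj₂ (all ys)
      }

    weaken : ∀ {k k′} {P′ : Pred A 0ℓ} → k′ ≤ k → P ⊆ P′ → AtLeast k P → AtLeast k′ P′
    weaken k′≤k P⊆P′ xs = record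
      { members = members xs ; unique = unique xs
      ; size = ≤-trans k′≤k (size xs) ; all = All.map P⊆P′ (all xs) }

    keep : ∀ {k m} {Q : Pred A 0ℓ} (Q? : Decidable Q) (xs : AtLeast m P) →
           k ≤ length (filter Q? (members xs)) → AtLeast k (Q ∩ P)
    keep Q? xs k≤ = record
      { members = filter Q? (members xs)
      ; unique  = Unique.filter⁺ Q? (unique xs)
      ; size    = k≤
      ; all     = All.zip (All.all-filter Q? (members xs) , All.filter⁺ Q? (all xs))
      }

    split : ∀ {a b} {Q : Pred A 0ℓ} (Q? : Decidable Q) → AtLeast (a + b) P →
            AtLeast a (Q ∩ P) ⊎ AtLeast b (∁ Q ∩ P)
    split Q? xs = Sum.map (keep Q? xs) (keep (∁? Q?) xs)
      (m+n≤o+p⇒m≤o⊎n≤p (≤-trans (size xs)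
        (length-filter-cover Q? (∁? Q?) (All.universal (λ x → toSum (Q? x)) (members xs)))))

    remove : ∀ {k} (_≟_ : DecidableEquality A) (y : A) → AtLeast (suc k) P → AtLeast k (λ u → u ≢ y × P u)
    remove _≟_ y xs = keep (λ u → ¬? (u ≟ y)) xs (s≤s⁻¹ (≤-trans (size xs) (length-filter-≢ _≟_ y (unique xs))))

    element : ∀ {k} → AtLeast k P → Fin k → A
    element xs i = lookup (members xs) (Fin.inject≤ i (size xs))

    element-injective : ∀ {k} (xs : AtLeast k P) {i j} → element xs i ≡ element xs j → i ≡ j
    element-injective xs {i} {j} eq = inject≤-injective _ _ i j (lookup-injective (unique xs) eq)

    element-satisfies : ∀ {k} (xs : AtLeast k P) i → P (element xs i)
    element-satisfies xs i = All.lookup (all xs) (∈-lookup _)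

map-injective : ∀ {A B : Set} {P : Pred A 0ℓ} {P′ : Pred B 0ℓ} {k} (f : A → B) →
                (∀ {x y} → f x ≡ f y → x ≡ y) → (∀ {x} → P x → P′ (f x)) → AtLeast k P → AtLeast k P′
map-injective f f-injective P⇒P′f xs = record
  { members = map f (members xs)
  ; unique  = Unique.map⁺ f-injective (unique xs)
  ; size    = ≤-trans (size xs) (≤-reflexive (sym (length-map f (members xs))))
  ; all     = All.map⁺ (All.map P⇒P′f (all xs))
  }

disjoint⇒≢ : ∀ {n} {X Y : Subset n} {x y} → Disjoint X Y → x ∈ X → y ∈ Y → x ≢ y
disjoint⇒≢ X∩Y=∅ x∈X x∈Y refl = X∩Y=∅ _ x∈X x∈Y

elements : ∀ {n} (V : Subset n) → AtLeast ∣ V ∣ (_∈ V)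
elements []            = empty
elements (outside ∷ V) = map-injective suc suc-injective there (elements V)
elements (inside ∷ V)  = cons here (map-injective suc suc-injective (λ x∈V → (λ ()) , there x∈V) (elements V))

reverse : ∀ {n} → Tournament n → Tournament n
reverse T = record
  { arc     = λ u v → arc T v u
  ; irrefl  = irrefl T
  ; total   = λ u v u≢v → total T v u (≢-sym u≢v)
  ; antisym = λ u v → antisym T v u
  }

along : ∀ {n} → Dir → Tournament n → Tournament n
along fwd T = T
along bwd T = reverse T

along-orient : ∀ {n} d {T : Tournament n} {A : Set} (f : A → Fin n) {a b} →
               arc (along d T) (f a) (f b) → ArcIn T (mapPair f (orient d a b))
along-orient fwd f ab = ab
along-orient bwd f ab = ab

module _ {n : ℕ} (T : Tournament n) where

  arc⇒≢ : ∀ {u v} → arc T u v → u ≢ v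
  arc⇒≢ uv refl = irrefl T _ uv

  ¬arc⇒arc : ∀ {u v} → u ≢ v → ¬ arc T v u → arc T u v
  ¬arc⇒arc {u} {v} u≢v ¬vu = [ id , (λ vu → contradiction vu ¬vu) ] (total T u v u≢v)

  arc? : ∀ u v → Dec (arc T u v)
  arc? u v with u ≟ v
  ... | yes refl = no (irrefl T u)
  ... | no u≢v   = [ yes , (λ vu → no (antisym T v u vu)) ] (total T u v u≢v)

  outdegree : Fin n → List (Fin n) → ℕ
  outdegree x ys = length (filter (arc? x) ys)

  indegree : Fin n → List (Fin n) → ℕ
  indegree y xs = length (filter (λ x → arc? x y) xs)

  outdegreeSum : List (Fin n) → List (Fin n) → ℕ
  outdegreeSum xs ys = sum (map (λ x → outdegree x ys) xs)

  outdegree-∷-self : ∀ y ys → outdegree y (y ∷ ys) ≡ outdegree y ys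
  outdegree-∷-self y ys with arc? y y
  ... | yes yy = contradiction yy (irrefl T y)
  ... | no _   = refl

  outdegreeSum-∷ : ∀ xs y ys → outdegreeSum xs (y ∷ ys) ≡ indegree y xs + outdegreeSum xs ys
  outdegreeSum-∷ []       y ys = refl
  outdegreeSum-∷ (x ∷ xs) y ys with ih ← outdegreeSum-∷ xs y ys | arc? x y
  ... | yes _ = cong suc (trans (cong (outdegree x ys +_) ih) (x∙yz≈y∙xz (outdegree x ys) (indegree y xs) (outdegreeSum xs ys)))
  ... | no _  = trans (cong (outdegree x ys +_) ih) (x∙yz≈y∙xz (outdegree x ys) (indegree y xs) (outdegreeSum xs ys))

  outdegree+indegree : ∀ {y ys} → All (y ≢_) ys → length ys ≤ outdegree y ys + indegree y ys
  outdegree+indegree y∉ys = length-filter-cover (arc? _) (λ x → arc? x _) (All.map (total T _ _) y∉ys)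

  outdegreeSum-lower : ∀ {ys} → Unique ys → length ys * length ys ≤ length ys + 2 * outdegreeSum ys ys
  outdegreeSum-lower []                     = z≤n
  outdegreeSum-lower {y ∷ ys} (y∉ys ∷ unique) = begin
    suc m * suc m                              ≡⟨ cong (suc m +_) (*-suc m m) ⟩
    suc m + (m + m * m)                        ≤⟨ +-monoʳ-≤ (suc m) (+-monoʳ-≤ m (outdegreeSum-lower unique)) ⟩
    suc m + (m + (m + 2 * s))                  ≡⟨ cong (suc m +_) (regroup m s) ⟩
    suc m + 2 * (m + s)                        ≤⟨ +-monoʳ-≤ (suc m) (*-monoʳ-≤ 2 (+-monoˡ-≤ s (outdegree+indegree y∉ys))) ⟩
    suc m + 2 * (o + i + s)                    ≡⟨ cong (λ t → suc m + 2 * t) (+-assoc o i s) ⟩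
    suc m + 2 * (o + (i + s))                  ≡⟨ cong (λ t → suc m + 2 * t) (sym (cong₂ _+_ (outdegree-∷-self y ys) (outdegreeSum-∷ ys y ys))) ⟩
    suc m + 2 * outdegreeSum (y ∷ ys) (y ∷ ys) ∎
    where
    open ≤-Reasoning
    m o i s : ℕ
    m = length ys
    o = outdegree y ys
    i = indegree y ys
    s = outdegreeSum ys ys
    regroup : ∀ m s → m + (m + 2 * s) ≡ 2 * (m + s)
    regroup = solve-∀

  Outdegree≥ : ℕ → Pred (Fin n) 0ℓ → Pred (Fin n) 0ℓ
  Outdegree≥ k Q x = Q x × AtLeast k (λ y → arc T x y × Q y)

  ∃-outdegree≥ : ∀ {k Q} → AtLeast (2 * k + 1) Q → ∃ (Outdegree≥ k Q)
  ∃-outdegree≥ {k} xs with any? (λ x → k ≤? outdegree x (members xs)) (members xs)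
  ... | yes some = let qx , k≤d = All.lookupAny (all xs) some
                   in Any.lookup some , qx , keep (arc? (Any.lookup some)) xs k≤d
  ... | no none  = contradiction (≤-trans (m≤m+n (2 * k) 1) (size xs)) (<⇒≱ m<2k)
    where
    m : ℕ
    m = length (members xs)
    instance
      m≢0 : NonZero m
      m≢0 = >-nonZero (≤-trans (m≤n+m 1 (2 * k)) (size xs))
    m<2k : m < 2 * k
    m<2k = m²≤m+2s⇒s+m≤mk⇒m<2k (outdegreeSum-lower (unique xs))
             (sum-map-< _ (All.map ≰⇒> (All.¬Any⇒All¬ (members xs) none)))

  two-outdegree≥ : ∀ {k Q} → AtLeast (2 * k + 2) Q →
                   ∃₂ λ x y → x ≢ y × Outdegree≥ k Q x × Outdegree≥ k Q y
  two-outdegree≥ {k} xs =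
    let x , x-good              = ∃-outdegree≥ (weaken (+-monoʳ-≤ (2 * k) (n≤1+n 1)) id xs)
        y , (y≢x , qy) , y-outs = ∃-outdegree≥ (remove _≟_ x (weaken (≤-reflexive (sym (+-suc (2 * k) 1))) id xs))
    in x , y , ≢-sym y≢x , x-good , qy , weaken ≤-refl (Product.map₂ proj₂) y-outs
module Brooms {n : ℕ} {Γ : Set} (V₁ V₂ : Subset n) where

  -- S, M and E are the colour-indexed arc relations of the start-, middle- and
  -- end-arcs, each read from x₁ towards x₄. Only the distinctions between vertices
  -- that follow neither from an arc nor from V₁ ∩ V₂ = ∅ are recorded.
  record Witness (B : Pred Γ 0ℓ) (S M E : Γ → Fin n → Fin n → Set) (s₁ s₂ : ℕ) : Set where
    field
      α β γ   : Γ
      colours : B α × B β × B γ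
      rainbow : Distinct3 α β γ
      x₂ x₃   : Fin n
      x₂∈     : x₂ ∈ V₁ ∪ V₂
      x₃∈     : x₃ ∈ V₁ ∪ V₂
      middle  : M β x₂ x₃
      starts  : AtLeast s₁ (λ u → S α u x₂ × u ∈ V₁ × u ≢ x₃)
      ends    : AtLeast s₂ (λ e → E γ x₃ e × e ∈ V₂ × e ≢ x₂)

  witness⇒broom : ∀ (T : Γ → Tournament n) {B : Pred Γ 0ℓ} (P : Path3) {s₁ s₂} → Disjoint V₁ V₂ →
    Witness B (λ c → arc (along (d₁ P) (T c))) (λ c → arc (along (d₂ P) (T c))) (λ c → arc (along (d₃ P) (T c))) s₁ s₂ →
    ContainsNRBroom T B (V₁ ∪ V₂) V₁ V₂ P s₁ s₂
  witness⇒broom T {B} P {s₁} {s₂} V₁∩V₂=∅ w =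
    φ , χ , φ-injective , φ∈ , start∈ , end∈ , χ∈B , arcs , (λ _ _ → refl) , (λ _ _ → refl) , (λ _ _ → rainbow)
    where
    open Witness w
    tip : Fin s₁ → Fin n
    tip = element starts
    leaf : Fin s₂ → Fin n
    leaf = element ends
    tip-ok : ∀ i → arc (along (d₁ P) (T α)) (tip i) x₂ × tip i ∈ V₁ × tip i ≢ x₃
    tip-ok = element-satisfies starts
    leaf-ok : ∀ j → arc (along (d₃ P) (T γ)) x₃ (leaf j) × leaf j ∈ V₂ × leaf j ≢ x₂
    leaf-ok = element-satisfies ends

    φ : BroomV s₁ s₂ → Fin n
    φ (start i) = tip i
    φ mid₂      = x₂
    φ mid₃      = x₃
    φ (end j)   = leaf j

    χ : BroomA s₁ s₂ → Γ
    χ (startArc _) = α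
    χ midArc       = β
    χ (endArc _)   = γ

    start∈ : ∀ i → tip i ∈ V₁
    start∈ i = proj₁ (proj₂ (tip-ok i))

    end∈ : ∀ j → leaf j ∈ V₂
    end∈ j = proj₁ (proj₂ (leaf-ok j))

    φ∈ : ∀ v → φ v ∈ V₁ ∪ V₂
    φ∈ (start i) = x∈p∪q⁺ (inj₁ (start∈ i))
    φ∈ mid₂      = x₂∈
    φ∈ mid₃      = x₃∈
    φ∈ (end j)   = x∈p∪q⁺ (inj₂ (end∈ j))

    χ∈B : ∀ a → B (χ a)
    χ∈B (startArc _) = proj₁ colours
    χ∈B midArc       = proj₁ (proj₂ colours)
    χ∈B (endArc _)   = proj₂ (proj₂ colours)

    arcs : ∀ a → ArcIn (T (χ a)) (mapPair φ (arcEnds P a))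
    arcs (startArc i) = along-orient (d₁ P) φ (proj₁ (tip-ok i))
    arcs midArc       = along-orient (d₂ P) φ middle
    arcs (endArc j)   = along-orient (d₃ P) φ (proj₁ (leaf-ok j))

    tip≢x₂ : ∀ i → tip i ≢ x₂
    tip≢x₂ i = arc⇒≢ (along (d₁ P) (T α)) (proj₁ (tip-ok i))
    tip≢x₃ : ∀ i → tip i ≢ x₃
    tip≢x₃ i = proj₂ (proj₂ (tip-ok i))
    tip≢leaf : ∀ i j → tip i ≢ leaf j
    tip≢leaf i j = disjoint⇒≢ V₁∩V₂=∅ (start∈ i) (end∈ j)
    x₂≢x₃ : x₂ ≢ x₃
    x₂≢x₃ = arc⇒≢ (along (d₂ P) (T β)) middle
    x₂≢leaf : ∀ j → x₂ ≢ leaf j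
    x₂≢leaf j = ≢-sym (proj₂ (proj₂ (leaf-ok j)))
    x₃≢leaf : ∀ j → x₃ ≢ leaf j
    x₃≢leaf j = arc⇒≢ (along (d₃ P) (T γ)) (proj₁ (leaf-ok j))

    φ-injective : ∀ a b → φ a ≡ φ b → a ≡ b
    φ-injective (start i) (start j) eq = cong start (element-injective starts eq)
    φ-injective (start i) mid₂      eq = contradiction eq (tip≢x₂ i)
    φ-injective (start i) mid₃      eq = contradiction eq (tip≢x₃ i)
    φ-injective (start i) (end j)   eq = contradiction eq (tip≢leaf i j)
    φ-injective mid₂ (start j)      eq = contradiction eq (≢-sym (tip≢x₂ j))
    φ-injective mid₂ mid₂           _  = refl
    φ-injective mid₂ mid₃           eq = contradiction eq x₂≢x₃
    φ-injective mid₂ (end j)        eq = contradiction eq (x₂≢leaf j)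
    φ-injective mid₃ (start j)      eq = contradiction eq (≢-sym (tip≢x₃ j))
    φ-injective mid₃ mid₂           eq = contradiction eq (≢-sym x₂≢x₃)
    φ-injective mid₃ mid₃           _  = refl
    φ-injective mid₃ (end j)        eq = contradiction eq (x₃≢leaf j)
    φ-injective (end i) (start j)   eq = contradiction eq (≢-sym (tip≢leaf j i))
    φ-injective (end i) mid₂        eq = contradiction eq (≢-sym (x₂≢leaf i))
    φ-injective (end i) mid₃        eq = contradiction eq (≢-sym (x₃≢leaf i))
    φ-injective (end i) (end j)     eq = cong end (element-injective ends eq)
  module Rainbow (V₁∩V₂=∅ : Disjoint V₁ V₂) {b₁ b₂ b₃ : Γ} (distinct : Distinct3 b₁ b₂ b₃) where

    OneOf : Pred Γ 0ℓ
    OneOf c = c ≡ b₁ ⊎ c ≡ b₂ ⊎ c ≡ b₃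

    b₁≢b₂ : b₁ ≢ b₂
    b₁≢b₂ = proj₁ distinct
    b₁≢b₃ : b₁ ≢ b₃
    b₁≢b₃ = proj₁ (proj₂ distinct)
    b₂≢b₃ : b₂ ≢ b₃
    b₂≢b₃ = proj₂ (proj₂ distinct)

    ≢-across : ∀ {x y} → x ∈ V₁ → y ∈ V₂ → x ≢ y
    ≢-across = disjoint⇒≢ V₁∩V₂=∅

    b₁∈ : OneOf b₁
    b₁∈ = inj₁ refl
    b₂∈ : OneOf b₂
    b₂∈ = inj₂ (inj₁ refl)
    b₃∈ : OneOf b₃
    b₃∈ = inj₂ (inj₂ refl)

    -- Take x, y ∈ V₁ with three S-b₂-in-neighbours in V₁
    -- each, the middle arc x → y being their M-b₁-arc. Either y has s₂ M-b₃-in-neighbours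
    -- in V₂, the end-tips, or it has 2s₂ + 1 M-b₃-out-neighbours there; among the latter
    -- some z has s₂ M-b₁-in-neighbours, and y → z in M-b₃ becomes the middle arc.
    module TurnAtX₃ (S M : Γ → Tournament n) {s₂ : ℕ} where

      TurnWitness : Set
      TurnWitness = Witness OneOf (λ c → arc (S c)) (λ c → arc (M c)) (λ c u v → arc (M c) v u) 2 s₂

      from-b₁-arc : ∀ {x₂ x₃} → s₂ + (2 * s₂ + 1) ≤ ∣ V₂ ∣ → arc (M b₁) x₂ x₃ →
                    Outdegree≥ (reverse (S b₂)) 3 (_∈ V₁) x₂ → Outdegree≥ (reverse (S b₂)) 3 (_∈ V₁) x₃ →
                    TurnWitness
      from-b₁-arc {x₂} {x₃} big₂ x₂x₃ (x₂∈ , x₂-ins) (x₃∈ , x₃-ins)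
        with split (λ e → arc? (M b₃) e x₃) (weaken big₂ id (elements V₂))
      ... | inj₁ into-x₃ = record
        { α = b₂ ; β = b₁ ; γ = b₃ ; colours = b₂∈ , b₁∈ , b₃∈ ; rainbow = ≢-sym b₁≢b₂ , b₂≢b₃ , b₁≢b₃
        ; x₂ = x₂ ; x₃ = x₃ ; x₂∈ = x∈p∪q⁺ (inj₁ x₂∈) ; x₃∈ = x∈p∪q⁺ (inj₁ x₃∈) ; middle = x₂x₃
        ; starts = weaken ≤-refl (λ (u≢x₃ , ux₂ , u∈) → ux₂ , u∈ , u≢x₃) (remove _≟_ x₃ x₂-ins)
        ; ends   = weaken ≤-refl (λ (ex₃ , e∈) → ex₃ , e∈ , ≢-sym (≢-across x₂∈ e∈)) into-x₃
        }
      ... | inj₂ not-into-x₃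
        with y , (x₃y , y∈) , y-ins ← ∃-outdegree≥ (reverse (M b₁))
               (weaken ≤-refl (λ (¬ex₃ , e∈) → ¬arc⇒arc (M b₃) (≢-across x₃∈ e∈) ¬ex₃ , e∈) not-into-x₃)
        = record
        { α = b₂ ; β = b₃ ; γ = b₁ ; colours = b₂∈ , b₃∈ , b₁∈ ; rainbow = b₂≢b₃ , ≢-sym b₁≢b₂ , ≢-sym b₁≢b₃
        ; x₂ = x₃ ; x₃ = y ; x₂∈ = x∈p∪q⁺ (inj₁ x₃∈) ; x₃∈ = x∈p∪q⁺ (inj₂ y∈) ; middle = x₃y
        ; starts = weaken (n≤1+n 2) (λ (ux₃ , u∈) → ux₃ , u∈ , ≢-across u∈ y∈) x₃-ins
        ; ends   = weaken ≤-refl (λ (ey , _ , e∈) → ey , e∈ , ≢-sym (≢-across x₃∈ e∈)) y-ins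
        }

      witness : 8 ≤ ∣ V₁ ∣ → s₂ + (2 * s₂ + 1) ≤ ∣ V₂ ∣ → TurnWitness
      witness 8≤∣V₁∣ big₂
        with p , q , p≢q , p-good , q-good ← two-outdegree≥ (reverse (S b₂)) (weaken 8≤∣V₁∣ id (elements V₁))
        with total (M b₁) p q p≢q
      ... | inj₁ pq = from-b₁-arc big₂ pq p-good q-good
      ... | inj₂ qp = from-b₁-arc big₂ qp q-good p-good

    -- Take p, q ∈ V₁ with two b₁-out-neighbours in V₁ and w, w′ ∈ V₂
    -- with s₂ + 1 b₃-out-neighbours in V₂. A b₂-arc from {p, q} to {w, w′} is a middle
    -- arc. Otherwise w and w′ both send b₂-arcs to p and q, and the b₁-arc between w and
    -- w′ is the middle arc, with p and q as start-tips.
    module TurnAtX₂ (R : Γ → Tournament n) {s₂ : ℕ} where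

      TurnWitness : Set
      TurnWitness = Witness OneOf (λ c u v → arc (R c) v u) (λ c → arc (R c)) (λ c → arc (R c)) 2 s₂

      from-b₂-arc : ∀ {x w} → Outdegree≥ (R b₁) 2 (_∈ V₁) x → Outdegree≥ (R b₃) (suc s₂) (_∈ V₂) w →
                    arc (R b₂) x w → TurnWitness
      from-b₂-arc {x} {w} (x∈ , x-outs) (w∈ , w-outs) xw = record
        { α = b₁ ; β = b₂ ; γ = b₃ ; colours = b₁∈ , b₂∈ , b₃∈ ; rainbow = distinct
        ; x₂ = x ; x₃ = w ; x₂∈ = x∈p∪q⁺ (inj₁ x∈) ; x₃∈ = x∈p∪q⁺ (inj₂ w∈) ; middle = xw
        ; starts = weaken ≤-refl (λ (xu , u∈) → xu , u∈ , ≢-across u∈ w∈) x-outs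
        ; ends   = weaken (n≤1+n s₂) (λ (we , e∈) → we , e∈ , ≢-sym (≢-across x∈ e∈)) w-outs
        }

      from-b₁-arc : ∀ {p q w w′} → p ≢ q → p ∈ V₁ → q ∈ V₁ → w ∈ V₂ →
                    arc (R b₂) w p → arc (R b₂) w q → arc (R b₁) w w′ →
                    Outdegree≥ (R b₃) (suc s₂) (_∈ V₂) w′ → TurnWitness
      from-b₁-arc {w = w} {w′} p≢q p∈ q∈ w∈ wp wq ww′ (w′∈ , w′-outs) = record
        { α = b₂ ; β = b₁ ; γ = b₃ ; colours = b₂∈ , b₁∈ , b₃∈ ; rainbow = ≢-sym b₁≢b₂ , b₂≢b₃ , b₁≢b₃
        ; x₂ = w ; x₃ = w′ ; x₂∈ = x∈p∪q⁺ (inj₂ w∈) ; x₃∈ = x∈p∪q⁺ (inj₂ w′∈) ; middle = ww′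
        ; starts = cons (wp , p∈ , ≢-across p∈ w′∈) (cons (p≢q , wq , q∈ , ≢-across q∈ w′∈) empty)
        ; ends   = weaken ≤-refl (λ (e≢w , w′e , e∈) → w′e , e∈ , e≢w) (remove _≟_ w w′-outs)
        }

      from-b₂-arc-or-dominated : ∀ {p q w} → Outdegree≥ (R b₁) 2 (_∈ V₁) p → Outdegree≥ (R b₁) 2 (_∈ V₁) q →
                                 Outdegree≥ (R b₃) (suc s₂) (_∈ V₂) w →
                                 TurnWitness ⊎ (arc (R b₂) w p × arc (R b₂) w q)
      from-b₂-arc-or-dominated p-good@(p∈ , _) q-good@(q∈ , _) w-good@(w∈ , _)
        with total (R b₂) _ _ (≢-across p∈ w∈) | total (R b₂) _ _ (≢-across q∈ w∈)
      ... | inj₁ pw | _       = inj₁ (from-b₂-arc p-good w-good pw)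
      ... | inj₂ _  | inj₁ qw = inj₁ (from-b₂-arc q-good w-good qw)
      ... | inj₂ wp | inj₂ wq = inj₂ (wp , wq)

      witness : 6 ≤ ∣ V₁ ∣ → 2 * suc s₂ + 2 ≤ ∣ V₂ ∣ → TurnWitness
      witness 6≤∣V₁∣ big₂
        with p , q , p≢q , p-good , q-good ← two-outdegree≥ (R b₁) (weaken 6≤∣V₁∣ id (elements V₁))
        with w , w′ , w≢w′ , w-good , w′-good ← two-outdegree≥ (R b₃) (weaken big₂ id (elements V₂))
        with from-b₂-arc-or-dominated p-good q-good w-good | from-b₂-arc-or-dominated p-good q-good w′-good
      ... | inj₁ witness | _            = witness
      ... | inj₂ _       | inj₁ witness = witness
      ... | inj₂ (wp , wq) | inj₂ (w′p , w′q) with total (R b₁) w w′ w≢w′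
      ...   | inj₁ ww′ = from-b₁-arc p≢q (proj₁ p-good) (proj₁ q-good) (proj₁ w-good) wp wq ww′ w′-good
      ...   | inj₂ w′w = from-b₁-arc p≢q (proj₁ p-good) (proj₁ q-good) (proj₁ w′-good) w′p w′q w′w w-good

proposition5p9 : ∀ {n : ℕ} (Γ : Set) (T : Γ → Tournament n) (V₁ V₂ : Subset n)
    → Disjoint V₁ V₂ → 50 ≤ ∣ V₁ ∣ → 300 ≤ ∣ V₂ ∣
    → (P : Path3) → Oscillating P
    → (b₁ b₂ b₃ : Γ) → Distinct3 b₁ b₂ b₃
    → ContainsNRBroom T (λ c → c ≡ b₁ ⊎ c ≡ b₂ ⊎ c ≡ b₃) (V₁ ∪ V₂) V₁ V₂ P 2 50
proposition5p9 Γ T V₁ V₂ V₁∩V₂=∅ 50≤∣V₁∣ 300≤∣V₂∣ P oscillating b₁ b₂ b₃ distinct =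
  witness⇒broom T P V₁∩V₂=∅ (witness P oscillating)
  where
  open Brooms V₁ V₂
  open Rainbow V₁∩V₂=∅ distinct

  V₁≥ : ∀ k {_ : True (k ≤? 50)} → k ≤ ∣ V₁ ∣
  V₁≥ k {k≤50} = ≤-trans (toWitness k≤50) 50≤∣V₁∣

  V₂≥ : ∀ k {_ : True (k ≤? 300)} → k ≤ ∣ V₂ ∣
  V₂≥ k {k≤300} = ≤-trans (toWitness k≤300) 300≤∣V₂∣

  witness : (P : Path3) → Oscillating P →
            Witness OneOf (λ c → arc (along (d₁ P) (T c))) (λ c → arc (along (d₂ P) (T c)))
                          (λ c → arc (along (d₃ P) (T c))) 2 50
  witness (path3 d fwd bwd)   _   = TurnAtX₃.witness (along d ∘ T) T            (V₁≥ 8) (V₂≥ 151)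
  witness (path3 d bwd fwd)   _   = TurnAtX₃.witness (along d ∘ T) (reverse ∘ T) (V₁≥ 8) (V₂≥ 151)
  witness (path3 bwd fwd fwd) _   = TurnAtX₂.witness T                          (V₁≥ 6) (V₂≥ 104)
  witness (path3 fwd bwd bwd) _   = TurnAtX₂.witness (reverse ∘ T)              (V₁≥ 6) (V₂≥ 104)
  witness (path3 fwd fwd fwd) osc = contradiction (refl , refl) osc
  witness (path3 bwd bwd bwd) osc = contradiction (refl , refl) osc
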